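{- Let $\lambda$ be a nonzero real number. For all integers $n,k\ge0$ with $n\ge k$, \[ S_{J,\lambda}^{(1)}(n,k)=\sum_{m=k}^{n}S_{1,\lambda}(n,m)\,S_{1,\lambda}(m,k). \]
   Context: For a nonzero real $\lambda$, let $\log_\lambda(1+t)=\frac{1}{\lambda}\big((1+t)^\lambda-1\big)$ (the compositional inverse of the degenerate exponential $e_\lambda(t)=(1+\lambda t)^{1/\lambda}$). The degenerate Stirling numbers of the first kind are defined by $\frac{1}{k!}(\log_\lambda(1+t))^k=\sum_{n\ge k}S_{1,\lambda}(n,k)\frac{t^n}{n!}$ for $k\ge0$, and the Jindalrae-Stirling numbers of the first kind by $\frac{1}{k!}\big(\log_\lambda(\log_\lambda(1+t)+1)\big)^k=\sum_{n\ge k}S_{J,\lambda}^{(1)}(n,k)\frac{t^n}{n!}$ for $k\ge0$ (formal power series in $t$). -}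

module Defs where

open import Level using (Level; suc; _⊔_)
open import Data.Nat as ℕ using (ℕ; zero; _∸_)
open import Relation.Nullary using (¬_)
open import Algebra.Bundles using (CommutativeRing)

ι : ∀ {c ℓ} (R : CommutativeRing c ℓ) → ℕ → CommutativeRing.Carrier R
ι R zero = CommutativeRing.0# R
ι R (ℕ.suc n) = CommutativeRing._+_ R (CommutativeRing.1# R) (ι R n)

-- A field of characteristic zero (e.g. the real numbers ℝ), given as a
-- commutative ring with a total inverse function that is a genuine inverse
-- on nonzero elements, and in which 1 + 1 + ... + 1 (n+1 times) is nonzero.
record CharZeroField (c ℓ : Level) : Set (suc (c ⊔ ℓ)) where
  field
    commutativeRing : CommutativeRing c ℓ
  open CommutativeRing commutativeRing public
  field
    _⁻¹         : Carrier → Carrier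
    ⁻¹-inverse  : ∀ x → ¬ (x ≈ 0#) → x * (x ⁻¹) ≈ 1#
    charZero : ∀ n → ¬ (ι commutativeRing (ℕ.suc n) ≈ 0#)

-- Formal power series in t over the field F, as coefficient sequences
-- (f n = coefficient of t^n).
module Series {c ℓ} (F : CharZeroField c ℓ) where
  open CharZeroField F hiding (zero)

  ιF : ℕ → Carrier
  ιF = ι commutativeRing

  PowerSeries : Set c
  PowerSeries = ℕ → Carrier

  sumTo : ℕ → (ℕ → Carrier) → Carrier
  sumTo zero f = f 0
  sumTo (ℕ.suc n) f = sumTo n f + f (ℕ.suc n)

  -- Σ_{m=k}^{n} f m   (meaningful for k ≤ n)
  sumFromTo : ℕ → ℕ → (ℕ → Carrier) → Carrier
  sumFromTo k n f = sumTo (n ∸ k) (λ j → f (k ℕ.+ j))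

  fact : ℕ → Carrier
  fact n = ιF (n ℕ.!)

  falling : Carrier → ℕ → Carrier
  falling x zero = 1#
  falling x (ℕ.suc n) = falling x n * (x - ιF n)

  _⊛_ : PowerSeries → PowerSeries → PowerSeries
  (f ⊛ g) n = sumTo n (λ i → f i * g (n ∸ i))

  oneS : PowerSeries
  oneS zero = 1#
  oneS (ℕ.suc n) = 0#

  powS : PowerSeries → ℕ → PowerSeries
  powS f zero = oneS
  powS f (ℕ.suc k) = f ⊛ powS f k

  -- composition f(s(t)) for s with zero constant term:
  -- [t^n] f(s) = Σ_{j=0}^{n} f_j [t^n] s^j
  _∘S_ : PowerSeries → PowerSeries → PowerSeries
  (f ∘S s) n = sumTo n (λ j → f j * powS s j n)

  -- (1+t)^λ = Σ_n (λ)_n / n! t^n  (binomial series)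
  onePlusTPow : Carrier → PowerSeries
  onePlusTPow lam n = falling lam n * (fact n ⁻¹)

  -- log_λ(1+t) = ((1+t)^λ - 1) / λ
  logλ : Carrier → PowerSeries
  logλ lam zero = (onePlusTPow lam zero - 1#) * (lam ⁻¹)
  logλ lam (ℕ.suc n) = onePlusTPow lam (ℕ.suc n) * (lam ⁻¹)

  -- degenerate Stirling numbers of the first kind:
  -- (1/k!) (log_λ(1+t))^k = Σ_n S_{1,λ}(n,k) t^n / n!
  S1 : Carrier → ℕ → ℕ → Carrier
  S1 lam n k = fact n * ((fact k ⁻¹) * powS (logλ lam) k n)

  -- Jindalrae-Stirling numbers of the first kind:
  -- (1/k!) (log_λ(log_λ(1+t)+1))^k = Σ_n S^{(1)}_{J,λ}(n,k) t^n / n!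
  -- log_λ(1+u) with u = log_λ(1+t) is the composition logλ ∘ logλ.
  SJ : Carrier → ℕ → ℕ → Carrier
  SJ lam n k = fact n * ((fact k ⁻¹) * powS (logλ lam ∘S logλ lam) k n)

-- Write L for the series log_λ(1+t); it has zero constant term. Composition with a
-- series of zero constant term is multiplicative, so (L ∘ L)^k = L^k ∘ L, and the
-- coefficient of t^n in L^k ∘ L is Σ_m [t^m] L^k · [t^n] L^m. Multiplying and dividing
-- the m-th summand by m! turns n!/k! times it into S_{1,λ}(n,m) S_{1,λ}(m,k), and the
-- summands with m < k vanish because L^k is divisible by t^k.
module Submission where

open import Defs
open import Data.Nat as ℕ using (ℕ; zero; suc; _∸_; _≤_; _<_; _!; _≤′_; ≤′-refl; ≤′-step; z≤n; s≤s)
import Data.Nat.Properties as ℕₚ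
open import Relation.Binary.PropositionalEquality as ≡ using (_≡_)
open import Relation.Nullary using (¬_)
import Algebra.Properties.CommutativeSemigroup as CommutativeSemigroupProperties
import Algebra.Solver.CommutativeMonoid as CommutativeMonoidSolver

module FiniteSums {c ℓ} (F : CharZeroField c ℓ) where
  open CharZeroField F hiding (zero)
  open Series F
  open import Relation.Binary.Reasoning.Setoid setoid
  open CommutativeSemigroupProperties +-commutativeSemigroup using (interchange)

  sumTo-cong : ∀ n {f g : ℕ → Carrier} → (∀ i → i ≤ n → f i ≈ g i) → sumTo n f ≈ sumTo n g
  sumTo-cong zero    f≈g = f≈g 0 z≤n
  sumTo-cong (suc n) f≈g =
    +-cong (sumTo-cong n (λ i i≤n → f≈g i (ℕₚ.m≤n⇒m≤1+n i≤n))) (f≈g (suc n) ℕₚ.≤-refl)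

  sumTo-zero : ∀ n {f : ℕ → Carrier} → (∀ i → i ≤ n → f i ≈ 0#) → sumTo n f ≈ 0#
  sumTo-zero zero    f≈0 = f≈0 0 z≤n
  sumTo-zero (suc n) f≈0 =
    trans (+-cong (sumTo-zero n (λ i i≤n → f≈0 i (ℕₚ.m≤n⇒m≤1+n i≤n))) (f≈0 (suc n) ℕₚ.≤-refl))
          (+-identityʳ 0#)

  sumTo-distrib-+ : ∀ n (f g : ℕ → Carrier) →
    sumTo n (λ i → f i + g i) ≈ sumTo n f + sumTo n g
  sumTo-distrib-+ zero    f g = refl
  sumTo-distrib-+ (suc n) f g =
    trans (+-congʳ (sumTo-distrib-+ n f g)) (interchange _ _ _ _)

  *-distribˡ-sumTo : ∀ n x (f : ℕ → Carrier) → x * sumTo n f ≈ sumTo n (λ i → x * f i)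
  *-distribˡ-sumTo zero    x f = refl
  *-distribˡ-sumTo (suc n) x f = trans (distribˡ x _ _) (+-congʳ (*-distribˡ-sumTo n x f))

  *-distribʳ-sumTo : ∀ n x (f : ℕ → Carrier) → sumTo n f * x ≈ sumTo n (λ i → f i * x)
  *-distribʳ-sumTo zero    x f = refl
  *-distribʳ-sumTo (suc n) x f = trans (distribʳ x _ _) (+-congʳ (*-distribʳ-sumTo n x f))

  sumTo-*-sumTo : ∀ m n (f g : ℕ → Carrier) →
    sumTo m f * sumTo n g ≈ sumTo m (λ i → sumTo n (λ j → f i * g j))
  sumTo-*-sumTo m n f g =
    trans (*-distribʳ-sumTo m _ f) (sumTo-cong m (λ i _ → *-distribˡ-sumTo n (f i) g))

  sumTo-comm : ∀ m n (f : ℕ → ℕ → Carrier) →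
    sumTo m (λ i → sumTo n (f i)) ≈ sumTo n (λ j → sumTo m (λ i → f i j))
  sumTo-comm zero    n f = refl
  sumTo-comm (suc m) n f =
    trans (+-congʳ (sumTo-comm m n f)) (sym (sumTo-distrib-+ n _ (f (suc m))))

  sumTo-truncate : ∀ {n m} {f : ℕ → Carrier} → n ≤ m → (∀ i → n < i → f i ≈ 0#) →
    sumTo m f ≈ sumTo n f
  sumTo-truncate {n} {f = f} n≤m f≈0 = go (ℕₚ.≤⇒≤′ n≤m)
    where
    go : ∀ {m} → n ≤′ m → sumTo m f ≈ sumTo n f
    go ≤′-refl        = refl
    go (≤′-step n≤′m) = trans (+-cong (go n≤′m) (f≈0 _ (s≤s (ℕₚ.≤′⇒≤ n≤′m)))) (+-identityʳ _)

  sumTo-unconsˡ : ∀ n (f : ℕ → Carrier) → sumTo (suc n) f ≈ f 0 + sumTo n (λ i → f (suc i))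
  sumTo-unconsˡ zero    f = refl
  sumTo-unconsˡ (suc n) f = trans (+-congʳ (sumTo-unconsˡ n f)) (+-assoc _ _ _)

  sumTo≈sumFromTo : ∀ {k n} {f : ℕ → Carrier} → k ≤ n → (∀ i → i < k → f i ≈ 0#) →
    sumTo n f ≈ sumFromTo k n f
  sumTo≈sumFromTo {zero}              _         _   = refl
  sumTo≈sumFromTo {suc k} {suc n} {f} (s≤s k≤n) f≈0 = begin
    sumTo (suc n) f                        ≈⟨ sumTo-unconsˡ n f ⟩
    f 0 + sumTo n (λ i → f (suc i))        ≈⟨ +-congʳ (f≈0 0 (s≤s z≤n)) ⟩
    0# + sumTo n (λ i → f (suc i))         ≈⟨ +-identityˡ _ ⟩
    sumTo n (λ i → f (suc i))              ≈⟨ sumTo≈sumFromTo k≤n (λ i i<k → f≈0 (suc i) (s≤s i<k)) ⟩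
    sumFromTo (suc k) (suc n) f            ∎

  sumFromTo-singleton : ∀ n (f : ℕ → Carrier) → sumFromTo n n f ≈ f n
  sumFromTo-singleton n f rewrite ℕₚ.n∸n≡0 n = reflexive (≡.cong f (ℕₚ.+-identityʳ n))

  sumFromTo-suc : ∀ {i n} (f : ℕ → Carrier) → i ≤ n →
    sumFromTo i (suc n) f ≈ sumFromTo i n f + f (suc n)
  sumFromTo-suc {i} {n} f i≤n rewrite ℕₚ.+-∸-assoc 1 i≤n =
    +-congˡ (reflexive (≡.cong f (≡.trans (ℕₚ.+-suc i (n ∸ i)) (≡.cong suc (ℕₚ.m+[n∸m]≡n i≤n)))))

module PowerSeriesAlgebra {c ℓ} (F : CharZeroField c ℓ) where
  open CharZeroField F hiding (zero)
  open Series F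
  open FiniteSums F
  open import Relation.Binary.Reasoning.Setoid setoid
  open CommutativeSemigroupProperties *-commutativeSemigroup using (interchange)

  ⊛-cong : ∀ {f f′ g g′ : PowerSeries} → (∀ i → f i ≈ f′ i) → (∀ i → g i ≈ g′ i) →
    ∀ n → (f ⊛ g) n ≈ (f′ ⊛ g′) n
  ⊛-cong f≈f′ g≈g′ n = sumTo-cong n (λ i _ → *-cong (f≈f′ i) (g≈g′ (n ∸ i)))

  sumTo-oneS-* : ∀ n (f : ℕ → Carrier) → sumTo n (λ i → oneS i * f i) ≈ f 0
  sumTo-oneS-* zero    f = *-identityˡ _
  sumTo-oneS-* (suc n) f = trans (+-cong (sumTo-oneS-* n f) (zeroˡ _)) (+-identityʳ _)

  ⊛-identityˡ : ∀ f n → (oneS ⊛ f) n ≈ f n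
  ⊛-identityˡ f n = sumTo-oneS-* n (λ i → f (n ∸ i))

  sumTo-triangle : ∀ n (f : ℕ → ℕ → Carrier) →
    sumTo n (λ j → sumTo j (λ i → f i j)) ≈ sumTo n (λ i → sumFromTo i n (f i))
  sumTo-triangle zero    f = refl
  sumTo-triangle (suc n) f = begin
    sumTo n (λ j → sumTo j (λ i → f i j)) + sumTo (suc n) (λ i → f i (suc n))
      ≈⟨ +-congʳ (sumTo-triangle n f) ⟩
    sumTo n (λ i → sumFromTo i n (f i)) + (sumTo n (λ i → f i (suc n)) + f (suc n) (suc n))
      ≈⟨ sym (+-assoc _ _ _) ⟩
    (sumTo n (λ i → sumFromTo i n (f i)) + sumTo n (λ i → f i (suc n))) + f (suc n) (suc n)
      ≈⟨ +-cong (sym (sumTo-distrib-+ n _ _)) (sym (sumFromTo-singleton (suc n) (f (suc n)))) ⟩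
    sumTo n (λ i → sumFromTo i n (f i) + f i (suc n)) + sumFromTo (suc n) (suc n) (f (suc n))
      ≈⟨ +-congʳ (sumTo-cong n (λ i i≤n → sym (sumFromTo-suc (f i) i≤n))) ⟩
    sumTo (suc n) (λ i → sumFromTo i (suc n) (f i)) ∎

  ⊛-assoc : ∀ f g h n → ((f ⊛ g) ⊛ h) n ≈ (f ⊛ (g ⊛ h)) n
  ⊛-assoc f g h n = begin
    sumTo n (λ j → sumTo j (λ i → f i * g (j ∸ i)) * h (n ∸ j))
      ≈⟨ sumTo-cong n (λ j _ → trans (*-distribʳ-sumTo j _ _) (sumTo-cong j (λ i _ → *-assoc _ _ _))) ⟩
    sumTo n (λ j → sumTo j (λ i → f i * (g (j ∸ i) * h (n ∸ j))))
      ≈⟨ sumTo-triangle n _ ⟩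
    sumTo n (λ i → sumTo (n ∸ i) (λ j → f i * (g (i ℕ.+ j ∸ i) * h (n ∸ (i ℕ.+ j)))))
      ≈⟨ sumTo-cong n (λ i _ → trans (sumTo-cong (n ∸ i) (λ j _ → reflexive (reindex i j)))
                                      (sym (*-distribˡ-sumTo (n ∸ i) (f i) _))) ⟩
    sumTo n (λ i → f i * sumTo (n ∸ i) (λ j → g j * h (n ∸ i ∸ j))) ∎
    where
    reindex : ∀ i j → f i * (g (i ℕ.+ j ∸ i) * h (n ∸ (i ℕ.+ j))) ≡ f i * (g j * h (n ∸ i ∸ j))
    reindex i j = ≡.cong₂ (λ a b → f i * (g a * h b)) (ℕₚ.m+n∸m≡n i j) (≡.sym (ℕₚ.∸-+-assoc n i j))

  powS-+ : ∀ s p q n → (powS s p ⊛ powS s q) n ≈ powS s (p ℕ.+ q) n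
  powS-+ s zero    q n = ⊛-identityˡ (powS s q) n
  powS-+ s (suc p) q n =
    trans (⊛-assoc s (powS s p) (powS s q) n) (⊛-cong (λ _ → refl) (powS-+ s p q) n)

  module Composition (s : PowerSeries) (s₀≈0 : s 0 ≈ 0#) where

    powS-vanishes : ∀ j a → a < j → powS s j a ≈ 0#
    powS-vanishes (suc j) a (s≤s a≤j) = sumTo-zero a term≈0
      where
      term≈0 : ∀ i → i ≤ a → s i * powS s j (a ∸ i) ≈ 0#
      term≈0 zero    _   = trans (*-congʳ s₀≈0) (zeroˡ _)
      term≈0 (suc i) i<a = trans (*-congˡ (powS-vanishes j (a ∸ suc i) a∸i<j)) (zeroʳ _)
        where a∸i<j = ℕₚ.<-≤-trans (ℕₚ.∸-monoʳ-< (s≤s z≤n) i<a) a≤j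

    ∘S-extend : ∀ f {a M} → a ≤ M → (f ∘S s) a ≈ sumTo M (λ p → f p * powS s p a)
    ∘S-extend f a≤M =
      sym (sumTo-truncate a≤M (λ p a<p → trans (*-congˡ (powS-vanishes p _ a<p)) (zeroʳ _)))

    ∘S-⊛ : ∀ f g n → ((f ∘S s) ⊛ (g ∘S s)) n ≈ ((f ⊛ g) ∘S s) n
    ∘S-⊛ f g n = trans ⊛-expanded (sym ∘S-expanded)
      where
      P : ℕ → ℕ → Carrier
      P = powS s

      W : Carrier
      W = sumTo n (λ p → sumTo n (λ q → (f p * g q) * P (p ℕ.+ q) n))

      ⊛-expanded : ((f ∘S s) ⊛ (g ∘S s)) n ≈ W
      ⊛-expanded = begin
        sumTo n (λ a → (f ∘S s) a * (g ∘S s) (n ∸ a))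
          ≈⟨ sumTo-cong n (λ a a≤n →
               trans (*-cong (∘S-extend f a≤n) (∘S-extend g (ℕₚ.m∸n≤m n a))) (sumTo-*-sumTo n n _ _)) ⟩
        sumTo n (λ a → sumTo n (λ p → sumTo n (λ q → (f p * P p a) * (g q * P q (n ∸ a)))))
          ≈⟨ trans (sumTo-comm n n _) (sumTo-cong n (λ p _ → sumTo-comm n n _)) ⟩
        sumTo n (λ p → sumTo n (λ q → sumTo n (λ a → (f p * P p a) * (g q * P q (n ∸ a)))))
          ≈⟨ sumTo-cong n (λ p _ → sumTo-cong n (λ q _ → begin
               sumTo n (λ a → (f p * P p a) * (g q * P q (n ∸ a)))
                 ≈⟨ sumTo-cong n (λ a _ → interchange _ _ _ _) ⟩
               sumTo n (λ a → (f p * g q) * (P p a * P q (n ∸ a)))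
                 ≈⟨ sym (*-distribˡ-sumTo n _ _) ⟩
               (f p * g q) * (P p ⊛ P q) n
                 ≈⟨ *-congˡ (powS-+ s p q n) ⟩
               (f p * g q) * P (p ℕ.+ q) n ∎)) ⟩
        W ∎

      ∘S-expanded : ((f ⊛ g) ∘S s) n ≈ W
      ∘S-expanded = begin
        sumTo n (λ c → (f ⊛ g) c * P c n)
          ≈⟨ sumTo-cong n (λ c _ → *-distribʳ-sumTo c _ _) ⟩
        sumTo n (λ c → sumTo c (λ p → (f p * g (c ∸ p)) * P c n))
          ≈⟨ sumTo-triangle n _ ⟩
        sumTo n (λ p → sumTo (n ∸ p) (λ q → (f p * g (p ℕ.+ q ∸ p)) * P (p ℕ.+ q) n))
          ≈⟨ sumTo-cong n (λ p p≤n → trans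
               (sumTo-cong (n ∸ p) (λ q _ →
                 reflexive (≡.cong (λ r → (f p * g r) * P (p ℕ.+ q) n) (ℕₚ.m+n∸m≡n p q))))
               (sym (sumTo-truncate (ℕₚ.m∸n≤m n p) (λ q n∸p<q →
                 trans (*-congˡ (powS-vanishes (p ℕ.+ q) n (n<p+q p≤n n∸p<q))) (zeroʳ _))))) ⟩
        W ∎
        where
        n<p+q : ∀ {p q} → p ≤ n → n ∸ p < q → n < p ℕ.+ q
        n<p+q {p} {q} p≤n n∸p<q = ≡.subst (_< p ℕ.+ q) (ℕₚ.m+[n∸m]≡n p≤n) (ℕₚ.+-monoʳ-< p n∸p<q)

    powS-∘S : ∀ f k n → powS (f ∘S s) k n ≈ (powS f k ∘S s) n
    powS-∘S f zero    n = sym (sumTo-oneS-* n (λ j → powS s j n))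
    powS-∘S f (suc k) n =
      trans (⊛-cong (λ _ → refl) (powS-∘S f k) n) (∘S-⊛ f (powS f k) n)

module DegenerateStirling {c ℓ} (F : CharZeroField c ℓ) (lam : CharZeroField.Carrier F) where
  open CharZeroField F hiding (zero)
  open Series F
  open FiniteSums F
  open PowerSeriesAlgebra F
  open import Relation.Binary.Reasoning.Setoid setoid
  module *-Solver = CommutativeMonoidSolver *-commutativeMonoid

  fact-≉0 : ∀ m → ¬ (fact m ≈ 0#)
  fact-≉0 m with m ! | ℕₚ.1≤n! m
  ... | suc r | _ = charZero r

  fact-inverseʳ : ∀ m → fact m * fact m ⁻¹ ≈ 1#
  fact-inverseʳ m = ⁻¹-inverse (fact m) (fact-≉0 m)

  logλ-constantTerm : logλ lam 0 ≈ 0#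
  logλ-constantTerm = begin
    (1# * fact 0 ⁻¹ - 1#) * lam ⁻¹ ≈⟨ *-congʳ (+-congʳ 1*0!⁻¹≈1) ⟩
    (1# - 1#) * lam ⁻¹             ≈⟨ *-congʳ (-‿inverseʳ 1#) ⟩
    0# * lam ⁻¹                    ≈⟨ zeroˡ _ ⟩
    0#                             ∎
    where
    1*0!⁻¹≈1 : 1# * fact 0 ⁻¹ ≈ 1#
    1*0!⁻¹≈1 = trans (*-congʳ (sym (+-identityʳ 1#))) (fact-inverseʳ 0)

  open Composition (logλ lam) logλ-constantTerm

  S1-vanishes : ∀ {m k} → m < k → S1 lam m k ≈ 0#
  S1-vanishes {m} {k} m<k =
    trans (*-congˡ (trans (*-congˡ (powS-vanishes k m m<k)) (zeroʳ _))) (zeroʳ _)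

  S1-*-S1 : ∀ n m k →
    S1 lam n m * S1 lam m k ≈ fact n * (fact k ⁻¹ * (powS (logλ lam) k m * powS (logλ lam) m n))
  S1-*-S1 n m k = begin
    (fact n * (fact m ⁻¹ * Lm)) * (fact m * (fact k ⁻¹ * Lk))
      ≈⟨ *-Solver.solve 6 (λ a b c d e f → ((a ⊕ (b ⊕ c)) ⊕ (d ⊕ (e ⊕ f)))
                                         ⊜ ((a ⊕ (e ⊕ (f ⊕ c))) ⊕ (d ⊕ b))) refl
           (fact n) (fact m ⁻¹) Lm (fact m) (fact k ⁻¹) Lk ⟩
    fact n * (fact k ⁻¹ * (Lk * Lm)) * (fact m * fact m ⁻¹)
      ≈⟨ *-congˡ (fact-inverseʳ m) ⟩
    fact n * (fact k ⁻¹ * (Lk * Lm)) * 1#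
      ≈⟨ *-identityʳ _ ⟩
    fact n * (fact k ⁻¹ * (Lk * Lm)) ∎
    where
    open *-Solver using (_⊕_; _⊜_)
    Lm = powS (logλ lam) m n
    Lk = powS (logλ lam) k m

  SJ≈sumTo-S1-*-S1 : ∀ n k → SJ lam n k ≈ sumTo n (λ m → S1 lam n m * S1 lam m k)
  SJ≈sumTo-S1-*-S1 n k = begin
    fact n * (fact k ⁻¹ * powS (logλ lam ∘S logλ lam) k n)
      ≈⟨ *-congˡ (*-congˡ (powS-∘S (logλ lam) k n)) ⟩
    fact n * (fact k ⁻¹ * sumTo n (λ m → powS (logλ lam) k m * powS (logλ lam) m n))
      ≈⟨ trans (*-congˡ (*-distribˡ-sumTo n _ _)) (*-distribˡ-sumTo n _ _) ⟩
    sumTo n (λ m → fact n * (fact k ⁻¹ * (powS (logλ lam) k m * powS (logλ lam) m n)))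
      ≈⟨ sumTo-cong n (λ m _ → sym (S1-*-S1 n m k)) ⟩
    sumTo n (λ m → S1 lam n m * S1 lam m k) ∎

theorem4 : ∀ {c ℓ} (F : CharZeroField c ℓ) →
    let open CharZeroField F in
    let open Series F in
    (lam : Carrier) → ¬ (lam ≈ 0#) →
    (n k : ℕ) → k ≤ n →
    SJ lam n k ≈ sumFromTo k n (λ m → S1 lam n m * S1 lam m k)
theorem4 F lam _ n k k≤n =
  trans (SJ≈sumTo-S1-*-S1 n k)
        (sumTo≈sumFromTo k≤n (λ m m<k → trans (*-congˡ (S1-vanishes m<k)) (zeroʳ _)))
  where
  open CharZeroField F hiding (zero)
  open FiniteSums F
  open DegenerateStirling F lam
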